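{- Let $\mathcal{C}(\widetilde{D}_4)$ be the point-line incidence structure with points $0,1,2,3,4$ and lines $\{0,2\},\{1,2\},\{2,3\},\{2,4\}$. Label its points by elements of $\overline{\mathcal{P}}_2$ via $0 \mapsto XI$, $1 \mapsto IX$, $2 \mapsto YY$, $3 \mapsto ZI$, $4 \mapsto IZ$, and label each geometric hyperplane by the product in $\overline{\mathcal{P}}_2$ of the labels of its points. Then this labeling restricts to a bijection between the $15$ geometric hyperplanes containing the point $2$ and the $15$ non-identity elements of $\overline{\mathcal{P}}_2$; for every three-point Veldkamp line the product of the labels of its three hyperplanes is the identity $II$; and the three-point Veldkamp lines whose three labels pairwise commute form, on these $15$ points, a copy of the symplectic polar space $W(3,2)$.
   Context: A geometric hyperplane is a proper subset $H$ of the point set such that every line is either contained in $H$ or meets $H$ in exactly one point. A three-point Veldkamp line is a set $\{H_1,H_2,H_3\}$ of three distinct geometric hyperplanes such that $H_3$ is the complement of $H_1 \triangle H_2$ in the point set. $\overline{\mathcal{P}}_N$ is the $N$-qubit Pauli group (generated by $N$-fold tensor products of the Pauli matrices $I,X,Y,Z$, with phases $i^\alpha$) modulo its center $\{\pm I^{\otimes N}, \pm i I^{\otimes N}\}$; its elements are identified with words $A_1A_2\cdots A_N$ standing for $A_1\otimes\cdots\otimes A_N$, $A_k \in \{I,X,Y,Z\}$, and it is abelian (products are taken ignoring phases). Two elements commute if representing matrices commute. $W(3,2)$ is the symplectic polar space of rank $2$ over $\mathrm{GF}(2)$ ($15$ points, $15$ lines of size three). -}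

module Defs where

open import Data.Bool using (Bool; true; false; _xor_; _∧_; not; if_then_else_)
open import Data.Nat using (ℕ)
open import Data.Fin using (Fin; zero; suc)
open import Data.Fin.Subset using (Subset; _∈_; _⊆_; _⊂_; ⊤; ∁; _∩_; ∣_∣)
open import Data.List using (List; []; _∷_)
open import Data.List.Membership.Propositional renaming (_∈_ to _∈ₗ_)
open import Data.Vec using (Vec; []; _∷_; zipWith; foldr; zip; map)
open import Data.Product using (_×_)
open import Data.Sum using (_⊎_)
open import Relation.Binary.PropositionalEquality using (_≡_; _≢_)

Point : Set
Point = Fin 5

p0 p1 p2 p3 p4 : Point
p0 = zero
p1 = suc zero
p2 = suc (suc zero)
p3 = suc (suc (suc zero))
p4 = suc (suc (suc (suc zero)))

lines : List (Subset 5)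
lines = (true  ∷ false ∷ true ∷ false ∷ false ∷ [])
      ∷ (false ∷ true  ∷ true ∷ false ∷ false ∷ [])
      ∷ (false ∷ false ∷ true ∷ true  ∷ false ∷ [])
      ∷ (false ∷ false ∷ true ∷ false ∷ true  ∷ [])
      ∷ []

IsLine : Subset 5 → Set
IsLine L = L ∈ₗ lines

IsGeomHyperplane : Subset 5 → Set
IsGeomHyperplane H =
  H ⊂ ⊤ × (∀ L → IsLine L → L ⊆ H ⊎ ∣ L ∩ H ∣ ≡ 1)

_Δ_ : Subset 5 → Subset 5 → Subset 5
A Δ B = zipWith _xor_ A B

-- three-point Veldkamp line {H1,H2,H3} (given as an ordered triple)
IsVeldkampLine : Subset 5 → Subset 5 → Subset 5 → Set
IsVeldkampLine H₁ H₂ H₃ =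
  IsGeomHyperplane H₁ × IsGeomHyperplane H₂ × IsGeomHyperplane H₃ ×
  H₁ ≢ H₂ × H₂ ≢ H₃ × H₁ ≢ H₃ ×
  H₃ ≡ ∁ (H₁ Δ H₂)

-- Pauli group modulo centre

data Pauli : Set where
  I X Y Z : Pauli

_·₁_ : Pauli → Pauli → Pauli
I ·₁ q = q
p ·₁ I = p
X ·₁ X = I
X ·₁ Y = Z
X ·₁ Z = Y
Y ·₁ X = Z
Y ·₁ Y = I
Y ·₁ Z = X
Z ·₁ X = Y
Z ·₁ Y = X
Z ·₁ Z = I

anticomm₁ : Pauli → Pauli → Bool
anticomm₁ I _ = false
anticomm₁ _ I = false
anticomm₁ X X = false
anticomm₁ Y Y = false
anticomm₁ Z Z = false
anticomm₁ _ _ = true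

Pauli2 : Set
Pauli2 = Pauli × Pauli

open import Data.Product using (_,_)

_·_ : Pauli2 → Pauli2 → Pauli2
(a , b) · (c , d) = (a ·₁ c , b ·₁ d)

II : Pauli2
II = (I , I)

-- tensor products commute iff an even number of factors anticommute
Commute : Pauli2 → Pauli2 → Set
Commute (a , b) (c , d) = (anticomm₁ a c xor anticomm₁ b d) ≡ false

pointLabel : Vec Pauli2 5
pointLabel = (X , I) ∷ (I , X) ∷ (Y , Y) ∷ (Z , I) ∷ (I , Z) ∷ []

label : Subset 5 → Pauli2
label H = foldr _ _·_ II
  (zipWith (λ b p → if b then p else II) H pointLabel)

-- The symplectic polar space W(3,2): points are the non-zero vectors of
-- GF(2)^4, lines are the totally isotropic 2-dim subspaces {u, v, u+v}
-- with respect to ω(x,y) = x₀y₁ + x₁y₀ + x₂y₃ + x₃y₂.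

V4 : Set
V4 = Vec Bool 4

zeroV : V4
zeroV = false ∷ false ∷ false ∷ false ∷ []

_+ᵥ_ : V4 → V4 → V4
u +ᵥ v = zipWith _xor_ u v

ω : V4 → V4 → Bool
ω (x₀ ∷ x₁ ∷ x₂ ∷ x₃ ∷ []) (y₀ ∷ y₁ ∷ y₂ ∷ y₃ ∷ []) =
  ((x₀ ∧ y₁) xor (x₁ ∧ y₀)) xor ((x₂ ∧ y₃) xor (x₃ ∧ y₂))

IsWPoint : V4 → Set
IsWPoint u = u ≢ zeroV

IsWLine : V4 → V4 → V4 → Set
IsWLine u v w =
  IsWPoint u × IsWPoint v × u ≢ v × w ≡ u +ᵥ v × ω u v ≡ false

-- Writing a Pauli word by its x- and z-bits identifies P̄₂ with GF(2)⁴ (products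
-- become sums, anticommutation becomes the symplectic form ω), and every
-- element is its own inverse. Every line of C(D̃₄) passes through 2, so the
-- hyperplanes through 2 are exactly the proper subsets containing it, while
-- {0,1,3,4} is the only hyperplane missing it; hence all Veldkamp lines live
-- among the 15 hyperplanes through 2. Since XI·IX·YY·ZI·IZ = II, the labelling
-- is a homomorphism sending complements of symmetric differences to products,
-- and on sets through 2 its coordinates are just the complemented indicator of
-- the other four points. So the labelling is a bijection onto P̄₂ ∖ {II} and
-- turns Veldkamp lines into triples {P, Q, PQ}, the commuting ones being the
-- lines of W(3,2).
module Submission where

open import Defs
open import Data.Fin.Subset using (Subset; _∈_)
open import Data.Product using (_×_; Σ)
open import Relation.Binary.PropositionalEquality using (_≡_; _≢_)

open import Algebra.Bundles using (AbelianGroup)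
open import Algebra.Structures using (IsAbelianGroup)
open import Data.Bool using (Bool; true; false; not; _∧_; _xor_; if_then_else_)
open import Data.Bool.Properties
  using (not-involutive; xor-assoc; xor-comm; xor-identityʳ; xor-same)
open import Data.Empty using (⊥-elim)
open import Data.Nat.Properties using (0≢1+n)
open import Data.Fin using (zero; suc)
open import Data.Fin.Subset using (_∉_; _⊂_; _⊆_; ⊤; ∁; _∩_; ∣_∣; ⁅_⁆)
open import Data.Fin.Subset.Properties using (∈⊤; drop-there; p∩q⊆q; _∈?_)
import Data.List.Relation.Unary.Any as List
open import Data.Product using (_,_; proj₁; proj₂)
open import Data.Sum using (_⊎_; inj₁; inj₂; map₁)
open import Data.Vec using (Vec; []; _∷_; zipWith; foldr; here; there)
open import Data.Vec.Properties using (zipWith-assoc; zipWith-comm; zipWith-identityʳ)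
open import Function using (_∘_)
open import Level using (0ℓ)
open import Relation.Binary.PropositionalEquality
  using (refl; sym; trans; cong; cong₂; subst; isEquivalence; module ≡-Reasoning)
open import Relation.Nullary using (¬_; yes; no)

open ≡-Reasoning

xcoord zcoord : Pauli → Bool
xcoord X = true
xcoord Y = true
xcoord _ = false
zcoord Z = true
zcoord Y = true
zcoord _ = false

pauli : Bool → Bool → Pauli
pauli false false = I
pauli true  false = X
pauli true  true  = Y
pauli false true  = Z

pauli-coords : ∀ p → pauli (xcoord p) (zcoord p) ≡ p
pauli-coords I = refl
pauli-coords X = refl
pauli-coords Y = refl
pauli-coords Z = refl

xcoord-· : ∀ p q → xcoord (p ·₁ q) ≡ xcoord p xor xcoord q
xcoord-· I _ = refl
xcoord-· X = λ { I → refl ; X → refl ; Y → refl ; Z → refl }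
xcoord-· Y = λ { I → refl ; X → refl ; Y → refl ; Z → refl }
xcoord-· Z = λ { I → refl ; X → refl ; Y → refl ; Z → refl }

zcoord-· : ∀ p q → zcoord (p ·₁ q) ≡ zcoord p xor zcoord q
zcoord-· I _ = refl
zcoord-· X = λ { I → refl ; X → refl ; Y → refl ; Z → refl }
zcoord-· Y = λ { I → refl ; X → refl ; Y → refl ; Z → refl }
zcoord-· Z = λ { I → refl ; X → refl ; Y → refl ; Z → refl }

anticomm₁-symplectic : ∀ p q →
  anticomm₁ p q ≡ (xcoord p ∧ zcoord q) xor (zcoord p ∧ xcoord q)
anticomm₁-symplectic I = λ { I → refl ; X → refl ; Y → refl ; Z → refl }
anticomm₁-symplectic X = λ { I → refl ; X → refl ; Y → refl ; Z → refl }
anticomm₁-symplectic Y = λ { I → refl ; X → refl ; Y → refl ; Z → refl }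
anticomm₁-symplectic Z = λ { I → refl ; X → refl ; Y → refl ; Z → refl }

anticomm₁-·ʳ : ∀ p q → anticomm₁ p (p ·₁ q) ≡ anticomm₁ p q
anticomm₁-·ʳ I = λ { I → refl ; X → refl ; Y → refl ; Z → refl }
anticomm₁-·ʳ X = λ { I → refl ; X → refl ; Y → refl ; Z → refl }
anticomm₁-·ʳ Y = λ { I → refl ; X → refl ; Y → refl ; Z → refl }
anticomm₁-·ʳ Z = λ { I → refl ; X → refl ; Y → refl ; Z → refl }

anticomm₁-·ˡ : ∀ p q → anticomm₁ q (p ·₁ q) ≡ anticomm₁ p q
anticomm₁-·ˡ I = λ { I → refl ; X → refl ; Y → refl ; Z → refl }
anticomm₁-·ˡ X = λ { I → refl ; X → refl ; Y → refl ; Z → refl }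
anticomm₁-·ˡ Y = λ { I → refl ; X → refl ; Y → refl ; Z → refl }
anticomm₁-·ˡ Z = λ { I → refl ; X → refl ; Y → refl ; Z → refl }

coords : Pauli2 → V4
coords (a , b) = xcoord a ∷ zcoord a ∷ xcoord b ∷ zcoord b ∷ []

fromCoords : V4 → Pauli2
fromCoords (x₁ ∷ z₁ ∷ x₂ ∷ z₂ ∷ []) = pauli x₁ z₁ , pauli x₂ z₂

coords-injective : ∀ {P Q} → coords P ≡ coords Q → P ≡ Q
coords-injective {a , b} {c , d} eq = begin
  (a , b)                     ≡⟨ cong₂ _,_ (pauli-coords a) (pauli-coords b) ⟨
  fromCoords (coords (a , b)) ≡⟨ cong fromCoords eq ⟩
  fromCoords (coords (c , d)) ≡⟨ cong₂ _,_ (pauli-coords c) (pauli-coords d) ⟩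
  (c , d)                     ∎

coords-· : ∀ P Q → coords (P · Q) ≡ coords P +ᵥ coords Q
coords-· (a , b) (c , d)
  rewrite xcoord-· a c | zcoord-· a c | xcoord-· b d | zcoord-· b d = refl

ω-coords : ∀ P Q →
  ω (coords P) (coords Q) ≡ anticomm₁ (proj₁ P) (proj₁ Q) xor anticomm₁ (proj₂ P) (proj₂ Q)
ω-coords (a , b) (c , d) =
  sym (cong₂ _xor_ (anticomm₁-symplectic a c) (anticomm₁-symplectic b d))

ω≡false⇒commute : ∀ P Q → ω (coords P) (coords Q) ≡ false → Commute P Q
ω≡false⇒commute P Q = trans (sym (ω-coords P Q))

commute⇒ω≡false : ∀ P Q → Commute P Q → ω (coords P) (coords Q) ≡ false
commute⇒ω≡false P Q = trans (ω-coords P Q)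

commute-·ʳ : ∀ P Q → Commute P Q → Commute P (P · Q)
commute-·ʳ (a , b) (c , d) = trans (cong₂ _xor_ (anticomm₁-·ʳ a c) (anticomm₁-·ʳ b d))

commute-·ˡ : ∀ P Q → Commute P Q → Commute Q (P · Q)
commute-·ˡ (a , b) (c , d) = trans (cong₂ _xor_ (anticomm₁-·ˡ a c) (anticomm₁-·ˡ b d))

+ᵥ-self : ∀ u → u +ᵥ u ≡ zeroV
+ᵥ-self (a ∷ b ∷ c ∷ d ∷ [])
  rewrite xor-same a | xor-same b | xor-same c | xor-same d = refl

·-isAbelianGroup : IsAbelianGroup _≡_ _·_ II (λ P → P)
·-isAbelianGroup = record
  { isGroup = record
    { isMonoid = record
      { isSemigroup = record
        { isMagma = record { isEquivalence = isEquivalence ; ∙-cong = cong₂ _·_ }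
        ; assoc = assoc
        }
      ; identity = (λ _ → refl) , identityʳ
      }
    ; inverse = selfInverse , selfInverse
    ; ⁻¹-cong = λ eq → eq
    }
  ; comm = comm
  }
  where
  assoc : ∀ P Q R → (P · Q) · R ≡ P · (Q · R)
  assoc P Q R = coords-injective (begin
    coords ((P · Q) · R)                  ≡⟨ coords-· (P · Q) R ⟩
    coords (P · Q) +ᵥ coords R            ≡⟨ cong (_+ᵥ coords R) (coords-· P Q) ⟩
    (coords P +ᵥ coords Q) +ᵥ coords R
      ≡⟨ zipWith-assoc {f = _xor_} xor-assoc (coords P) (coords Q) (coords R) ⟩
    coords P +ᵥ (coords Q +ᵥ coords R)    ≡⟨ cong (coords P +ᵥ_) (coords-· Q R) ⟨
    coords P +ᵥ coords (Q · R)            ≡⟨ coords-· P (Q · R) ⟨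
    coords (P · (Q · R))                  ∎)
  identityʳ : ∀ P → P · II ≡ P
  identityʳ P = coords-injective
    (trans (coords-· P II) (zipWith-identityʳ {f = _xor_} xor-identityʳ (coords P)))
  selfInverse : ∀ P → P · P ≡ II
  selfInverse P = coords-injective (trans (coords-· P P) (+ᵥ-self (coords P)))
  comm : ∀ P Q → P · Q ≡ Q · P
  comm P Q = coords-injective (begin
    coords (P · Q)          ≡⟨ coords-· P Q ⟩
    coords P +ᵥ coords Q    ≡⟨ zipWith-comm xor-comm (coords P) (coords Q) ⟩
    coords Q +ᵥ coords P    ≡⟨ coords-· Q P ⟨
    coords (Q · P)          ∎)

·-abelianGroup : AbelianGroup 0ℓ 0ℓ
·-abelianGroup = record { isAbelianGroup = ·-isAbelianGroup }

open AbelianGroup ·-abelianGroup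
  using () renaming (identityʳ to ·-identityʳ; inverseʳ to ·-selfInverse)
open import Algebra.Properties.Group (AbelianGroup.group ·-abelianGroup)
  using (identityˡ-unique; identityʳ-unique)
open import Algebra.Properties.CommutativeSemigroup
  (AbelianGroup.commutativeSemigroup ·-abelianGroup) using (interchange)

select : Bool → Pauli2 → Pauli2
select b P = if b then P else II

-- label = labelWith pointLabel holds definitionally.
labelWith : ∀ {n} → Vec Pauli2 n → Subset n → Pauli2
labelWith ls H = foldr _ _·_ II (zipWith select H ls)

select-xor : ∀ a b P → select (a xor b) P ≡ select a P · select b P
select-xor true  true  P = sym (·-selfInverse P)
select-xor true  false P = sym (·-identityʳ P)
select-xor false b     P = refl

select-not : ∀ a P → select (not a) P ≡ select a P · P
select-not true  P = sym (·-selfInverse P)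
select-not false P = refl

labelWith-Δ : ∀ {n} (ls : Vec Pauli2 n) A B →
  labelWith ls (zipWith _xor_ A B) ≡ labelWith ls A · labelWith ls B
labelWith-Δ [] [] [] = refl
labelWith-Δ (P ∷ ls) (a ∷ A) (b ∷ B) = begin
  select (a xor b) P · labelWith ls (zipWith _xor_ A B)
    ≡⟨ cong₂ _·_ (select-xor a b P) (labelWith-Δ ls A B) ⟩
  (select a P · select b P) · (labelWith ls A · labelWith ls B)
    ≡⟨ interchange (select a P) _ (labelWith ls A) _ ⟩
  (select a P · labelWith ls A) · (select b P · labelWith ls B) ∎

labelWith-∁ : ∀ {n} (ls : Vec Pauli2 n) A →
  labelWith ls (∁ A) ≡ labelWith ls A · labelWith ls ⊤
labelWith-∁ [] [] = refl
labelWith-∁ (P ∷ ls) (a ∷ A) = begin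
  select (not a) P · labelWith ls (∁ A)
    ≡⟨ cong₂ _·_ (select-not a P) (labelWith-∁ ls A) ⟩
  (select a P · P) · (labelWith ls A · labelWith ls ⊤)
    ≡⟨ interchange (select a P) P (labelWith ls A) _ ⟩
  (select a P · labelWith ls A) · (P · labelWith ls ⊤) ∎

-- XI · IX · YY · ZI · IZ = II, so complementation does not change labels.
label-∁Δ : ∀ A B → label (∁ (A Δ B)) ≡ label A · label B
label-∁Δ A B = begin
  label (∁ (A Δ B))      ≡⟨ labelWith-∁ pointLabel (A Δ B) ⟩
  label (A Δ B) · II     ≡⟨ ·-identityʳ _ ⟩
  label (A Δ B)          ≡⟨ labelWith-Δ pointLabel A B ⟩
  label A · label B      ∎

∈-∁Δ⁺ : ∀ {n} {x} {A B : Subset n} → x ∈ A → x ∈ B → x ∈ ∁ (zipWith _xor_ A B)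
∈-∁Δ⁺ here here = here
∈-∁Δ⁺ (there x∈A) (there x∈B) = there (∈-∁Δ⁺ x∈A x∈B)

∈-∁Δ-∈ʳ : ∀ {n} {x} {A B : Subset n} → x ∈ ∁ (zipWith _xor_ A B) → x ∈ A → x ∈ B
∈-∁Δ-∈ʳ {B = true ∷ _} here here = here
∈-∁Δ-∈ʳ {B = _ ∷ _} (there x∈Δ) (there x∈A) = there (∈-∁Δ-∈ʳ x∈Δ x∈A)

∈-∁Δ-∈ˡ : ∀ {n} {x} {A B : Subset n} → x ∈ ∁ (zipWith _xor_ A B) → x ∈ B → x ∈ A
∈-∁Δ-∈ˡ {A = true ∷ _} here here = here
∈-∁Δ-∈ˡ {A = _ ∷ _} (there x∈Δ) (there x∈B) = there (∈-∁Δ-∈ˡ x∈Δ x∈B)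

≢⊤⇒⊂⊤ : ∀ {n} {A : Subset n} → A ≢ ⊤ → A ⊂ ⊤
≢⊤⇒⊂⊤ {A = []} A≢⊤ = ⊥-elim (A≢⊤ refl)
≢⊤⇒⊂⊤ {A = false ∷ _} _ = (λ _ → ∈⊤) , zero , here , λ ()
≢⊤⇒⊂⊤ {A = true ∷ _} A≢⊤ with ≢⊤⇒⊂⊤ (A≢⊤ ∘ cong (true ∷_))
... | _ , x , _ , x∉A = (λ _ → ∈⊤) , suc x , ∈⊤ , x∉A ∘ drop-there

hyperplane-≢⊤ : ∀ {H} → IsGeomHyperplane H → H ≢ ⊤
hyperplane-≢⊤ ((_ , _ , _ , x∉H) , _) refl = x∉H ∈⊤

p2∈⇒meetsLines : ∀ {H} → p2 ∈ H → ∀ L → IsLine L → L ∩ H ≡ L ⊎ ∣ L ∩ H ∣ ≡ 1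
p2∈⇒meetsLines {true  ∷ _ ∷ _ ∷ _ ∷ _ ∷ []} (there (there here)) _ (List.here refl) = inj₁ refl
p2∈⇒meetsLines {false ∷ _ ∷ _ ∷ _ ∷ _ ∷ []} (there (there here)) _ (List.here refl) = inj₂ refl
p2∈⇒meetsLines {_ ∷ true  ∷ _ ∷ _ ∷ _ ∷ []} (there (there here)) _
  (List.there (List.here refl)) = inj₁ refl
p2∈⇒meetsLines {_ ∷ false ∷ _ ∷ _ ∷ _ ∷ []} (there (there here)) _
  (List.there (List.here refl)) = inj₂ refl
p2∈⇒meetsLines {_ ∷ _ ∷ _ ∷ true  ∷ _ ∷ []} (there (there here)) _
  (List.there (List.there (List.here refl))) = inj₁ refl
p2∈⇒meetsLines {_ ∷ _ ∷ _ ∷ false ∷ _ ∷ []} (there (there here)) _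
  (List.there (List.there (List.here refl))) = inj₂ refl
p2∈⇒meetsLines {_ ∷ _ ∷ _ ∷ _ ∷ true  ∷ []} (there (there here)) _
  (List.there (List.there (List.there (List.here refl)))) = inj₁ refl
p2∈⇒meetsLines {_ ∷ _ ∷ _ ∷ _ ∷ false ∷ []} (there (there here)) _
  (List.there (List.there (List.there (List.here refl)))) = inj₂ refl

p2∈⇒hyperplane : ∀ {H} → p2 ∈ H → H ≢ ⊤ → IsGeomHyperplane H
p2∈⇒hyperplane {H} p2∈H H≢⊤ = ≢⊤⇒⊂⊤ H≢⊤ , λ L isLine →
  map₁ (λ L∩H≡L → subst (_⊆ H) L∩H≡L (p∩q⊆q L H)) (p2∈⇒meetsLines p2∈H L isLine)

disjoint-¬hyperplaneCondition : ∀ {n} {x} {L H : Subset n} →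
  x ∈ L → x ∉ H → ∣ L ∩ H ∣ ≡ 0 → ¬ (L ⊆ H ⊎ ∣ L ∩ H ∣ ≡ 1)
disjoint-¬hyperplaneCondition x∈L x∉H _ (inj₁ L⊆H) = x∉H (L⊆H x∈L)
disjoint-¬hyperplaneCondition _ _ L∩H≡0 (inj₂ L∩H≡1) = 0≢1+n (trans (sym L∩H≡0) L∩H≡1)

p2∉⇒hyperplane≡∁⁅p2⁆ : ∀ {H} → IsGeomHyperplane H → p2 ∉ H → H ≡ ∁ ⁅ p2 ⁆
p2∉⇒hyperplane≡∁⁅p2⁆ {_ ∷ _ ∷ true ∷ _} _ p2∉H = ⊥-elim (p2∉H (there (there here)))
p2∉⇒hyperplane≡∁⁅p2⁆ {true ∷ true ∷ false ∷ true ∷ true ∷ []} _ _ = refl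
p2∉⇒hyperplane≡∁⁅p2⁆ {false ∷ _ ∷ false ∷ _ ∷ _ ∷ []} (_ , meets) p2∉H =
  ⊥-elim (disjoint-¬hyperplaneCondition (there (there here)) p2∉H refl
    (meets _ (List.here refl)))
p2∉⇒hyperplane≡∁⁅p2⁆ {true ∷ false ∷ false ∷ _ ∷ _ ∷ []} (_ , meets) p2∉H =
  ⊥-elim (disjoint-¬hyperplaneCondition (there (there here)) p2∉H refl
    (meets _ (List.there (List.here refl))))
p2∉⇒hyperplane≡∁⁅p2⁆ {true ∷ true ∷ false ∷ false ∷ _ ∷ []} (_ , meets) p2∉H =
  ⊥-elim (disjoint-¬hyperplaneCondition (there (there here)) p2∉H refl
    (meets _ (List.there (List.there (List.here refl)))))
p2∉⇒hyperplane≡∁⁅p2⁆ {true ∷ true ∷ false ∷ true ∷ false ∷ []} (_ , meets) p2∉H =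
  ⊥-elim (disjoint-¬hyperplaneCondition (there (there here)) p2∉H refl
    (meets _ (List.there (List.there (List.there (List.here refl))))))

hyperplanes-missing-p2-coincide : ∀ {H K} → IsGeomHyperplane H → IsGeomHyperplane K →
  p2 ∉ H → p2 ∉ K → H ≡ K
hyperplanes-missing-p2-coincide hH hK p2∉H p2∉K =
  trans (p2∉⇒hyperplane≡∁⁅p2⁆ hH p2∉H) (sym (p2∉⇒hyperplane≡∁⁅p2⁆ hK p2∉K))

veldkampLine-p2∈ : ∀ {H₁ H₂ H₃} → IsVeldkampLine H₁ H₂ H₃ → p2 ∈ H₁ × p2 ∈ H₂ × p2 ∈ H₃
veldkampLine-p2∈ {H₁} {H₂} (h₁ , h₂ , h₃ , H₁≢H₂ , H₂≢H₃ , H₁≢H₃ , refl)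
  with p2 ∈? H₁ | p2 ∈? H₂
... | yes p2∈H₁ | yes p2∈H₂ = p2∈H₁ , p2∈H₂ , ∈-∁Δ⁺ p2∈H₁ p2∈H₂
... | yes p2∈H₁ | no  p2∉H₂ = ⊥-elim (H₂≢H₃
  (hyperplanes-missing-p2-coincide h₂ h₃ p2∉H₂ (λ p2∈H₃ → p2∉H₂ (∈-∁Δ-∈ʳ p2∈H₃ p2∈H₁))))
... | no  p2∉H₁ | yes p2∈H₂ = ⊥-elim (H₁≢H₃
  (hyperplanes-missing-p2-coincide h₁ h₃ p2∉H₁ (λ p2∈H₃ → p2∉H₁ (∈-∁Δ-∈ˡ p2∈H₃ p2∈H₂))))
... | no  p2∉H₁ | no  p2∉H₂ = ⊥-elim (H₁≢H₂
  (hyperplanes-missing-p2-coincide h₁ h₂ p2∉H₁ p2∉H₂))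

φ : Subset 5 → V4
φ H = coords (label H)

cong₄ : ∀ {A B : Set} (f : A → A → A → A → B) {a a′ b b′ c c′ d d′} →
  a ≡ a′ → b ≡ b′ → c ≡ c′ → d ≡ d′ → f a b c d ≡ f a′ b′ c′ d′
cong₄ f refl refl refl refl = refl

φ⁻¹ : V4 → Subset 5
φ⁻¹ (x₁ ∷ z₁ ∷ x₂ ∷ z₂ ∷ []) = not x₁ ∷ not x₂ ∷ true ∷ not z₁ ∷ not z₂ ∷ []

φ-through-p2 : ∀ b₀ b₁ b₃ b₄ →
  φ (b₀ ∷ b₁ ∷ true ∷ b₃ ∷ b₄ ∷ []) ≡ not b₀ ∷ not b₃ ∷ not b₁ ∷ not b₄ ∷ []
φ-through-p2 true  true  = λ { true true → refl ; true false → refl ; false true → refl ; false false → refl }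
φ-through-p2 true  false = λ { true true → refl ; true false → refl ; false true → refl ; false false → refl }
φ-through-p2 false true  = λ { true true → refl ; true false → refl ; false true → refl ; false false → refl }
φ-through-p2 false false = λ { true true → refl ; true false → refl ; false true → refl ; false false → refl }

φ-φ⁻¹ : ∀ u → φ (φ⁻¹ u) ≡ u
φ-φ⁻¹ (x₁ ∷ z₁ ∷ x₂ ∷ z₂ ∷ []) = begin
  φ (φ⁻¹ (x₁ ∷ z₁ ∷ x₂ ∷ z₂ ∷ []))
    ≡⟨ φ-through-p2 (not x₁) (not x₂) (not z₁) (not z₂) ⟩
  not (not x₁) ∷ not (not z₁) ∷ not (not x₂) ∷ not (not z₂) ∷ []
    ≡⟨ cong₄ (λ a b c d → a ∷ b ∷ c ∷ d ∷ [])
         (not-involutive x₁) (not-involutive z₁) (not-involutive x₂) (not-involutive z₂) ⟩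
  x₁ ∷ z₁ ∷ x₂ ∷ z₂ ∷ [] ∎

φ⁻¹-φ : ∀ {H} → p2 ∈ H → φ⁻¹ (φ H) ≡ H
φ⁻¹-φ {b₀ ∷ b₁ ∷ true ∷ b₃ ∷ b₄ ∷ []} (there (there here)) = begin
  φ⁻¹ (φ (b₀ ∷ b₁ ∷ true ∷ b₃ ∷ b₄ ∷ []))
    ≡⟨ cong φ⁻¹ (φ-through-p2 b₀ b₁ b₃ b₄) ⟩
  not (not b₀) ∷ not (not b₁) ∷ true ∷ not (not b₃) ∷ not (not b₄) ∷ []
    ≡⟨ cong₄ (λ a b c d → a ∷ b ∷ true ∷ c ∷ d ∷ [])
         (not-involutive b₀) (not-involutive b₁) (not-involutive b₃) (not-involutive b₄) ⟩
  b₀ ∷ b₁ ∷ true ∷ b₃ ∷ b₄ ∷ [] ∎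

p2∈φ⁻¹ : ∀ u → p2 ∈ φ⁻¹ u
p2∈φ⁻¹ (_ ∷ _ ∷ _ ∷ _ ∷ []) = there (there here)

φ-injective : ∀ {H K} → p2 ∈ H → p2 ∈ K → φ H ≡ φ K → H ≡ K
φ-injective {H} {K} p2∈H p2∈K φH≡φK = begin
  H            ≡⟨ φ⁻¹-φ p2∈H ⟨
  φ⁻¹ (φ H)    ≡⟨ cong φ⁻¹ φH≡φK ⟩
  φ⁻¹ (φ K)    ≡⟨ φ⁻¹-φ p2∈K ⟩
  K            ∎

hyperplane-φ≢0 : ∀ {H} → IsGeomHyperplane H → p2 ∈ H → φ H ≢ zeroV
hyperplane-φ≢0 hH p2∈H φH≡0 = hyperplane-≢⊤ hH (φ-injective p2∈H ∈⊤ φH≡0)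

φ-surjective : ∀ u → u ≢ zeroV → Σ (Subset 5) λ H → IsGeomHyperplane H × p2 ∈ H × φ H ≡ u
φ-surjective u u≢0 = φ⁻¹ u , p2∈⇒hyperplane (p2∈φ⁻¹ u) φ⁻¹u≢⊤ , p2∈φ⁻¹ u , φ-φ⁻¹ u
  where
  φ⁻¹u≢⊤ : φ⁻¹ u ≢ ⊤
  φ⁻¹u≢⊤ φ⁻¹u≡⊤ = u≢0 (trans (sym (φ-φ⁻¹ u)) (cong φ φ⁻¹u≡⊤))

φ-∁Δ : ∀ A B → φ (∁ (A Δ B)) ≡ φ A +ᵥ φ B
φ-∁Δ A B = trans (cong coords (label-∁Δ A B)) (coords-· (label A) (label B))

label-≢II : ∀ {H} → IsGeomHyperplane H → p2 ∈ H → label H ≢ II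
label-≢II hH p2∈H = hyperplane-φ≢0 hH p2∈H ∘ cong coords

label-injective : ∀ {H K} → p2 ∈ H → p2 ∈ K → label H ≡ label K → H ≡ K
label-injective p2∈H p2∈K = φ-injective p2∈H p2∈K ∘ cong coords

label-surjective : ∀ P → P ≢ II → Σ (Subset 5) λ H → IsGeomHyperplane H × p2 ∈ H × label H ≡ P
label-surjective P P≢II with φ-surjective (coords P) (P≢II ∘ coords-injective)
... | H , hH , p2∈H , φH≡coordsP = H , hH , p2∈H , coords-injective φH≡coordsP

veldkampLine-label : ∀ {H₁ H₂ H₃} → IsVeldkampLine H₁ H₂ H₃ → label H₃ ≡ label H₁ · label H₂
veldkampLine-label {H₁} {H₂} (_ , _ , _ , _ , _ , _ , refl) = label-∁Δ H₁ H₂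

veldkampLine-product : ∀ {H₁ H₂ H₃} → IsVeldkampLine H₁ H₂ H₃ →
  (label H₁ · label H₂) · label H₃ ≡ II
veldkampLine-product {H₁} {H₂} v =
  trans (cong ((label H₁ · label H₂) ·_) (veldkampLine-label v)) (·-selfInverse (label H₁ · label H₂))

commutingVeldkampLine⇒WLine : ∀ {H₁ H₂ H₃} → IsVeldkampLine H₁ H₂ H₃ →
  Commute (label H₁) (label H₂) →
  (p2 ∈ H₁ × p2 ∈ H₂ × p2 ∈ H₃) × IsWLine (φ H₁) (φ H₂) (φ H₃)
commutingVeldkampLine⇒WLine {H₁} {H₂} v@(h₁ , h₂ , _ , H₁≢H₂ , _ , _ , refl) c₁₂
  with veldkampLine-p2∈ v
... | p2∈H₁ , p2∈H₂ , p2∈H₃ =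
  (p2∈H₁ , p2∈H₂ , p2∈H₃) ,
  hyperplane-φ≢0 h₁ p2∈H₁ , hyperplane-φ≢0 h₂ p2∈H₂ ,
  H₁≢H₂ ∘ φ-injective p2∈H₁ p2∈H₂ , φ-∁Δ H₁ H₂ ,
  commute⇒ω≡false (label H₁) (label H₂) c₁₂

WLine⇒commutingVeldkampLine : ∀ {H₁ H₂ H₃} →
  IsGeomHyperplane H₁ → p2 ∈ H₁ → IsGeomHyperplane H₂ → p2 ∈ H₂ →
  IsGeomHyperplane H₃ → p2 ∈ H₃ → IsWLine (φ H₁) (φ H₂) (φ H₃) →
  IsVeldkampLine H₁ H₂ H₃ × Commute (label H₁) (label H₂)
  × Commute (label H₂) (label H₃) × Commute (label H₁) (label H₃)
WLine⇒commutingVeldkampLine {H₁} {H₂} {H₃} h₁ p2∈H₁ h₂ p2∈H₂ h₃ p2∈H₃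
  (φH₁≢0 , φH₂≢0 , φH₁≢φH₂ , φH₃≡φH₁+φH₂ , ω≡false) =
  (h₁ , h₂ , h₃ , φH₁≢φH₂ ∘ cong φ , H₂≢H₃ , H₁≢H₃ , H₃≡∁Δ) , c₁₂ ,
  subst (Commute (label H₂)) (sym label₃) (commute-·ˡ (label H₁) (label H₂) c₁₂) ,
  subst (Commute (label H₁)) (sym label₃) (commute-·ʳ (label H₁) (label H₂) c₁₂)
  where
  label₃ : label H₃ ≡ label H₁ · label H₂
  label₃ = coords-injective (trans φH₃≡φH₁+φH₂ (sym (coords-· (label H₁) (label H₂))))
  H₃≡∁Δ : H₃ ≡ ∁ (H₁ Δ H₂)
  H₃≡∁Δ = φ-injective p2∈H₃ (∈-∁Δ⁺ p2∈H₁ p2∈H₂) (trans φH₃≡φH₁+φH₂ (sym (φ-∁Δ H₁ H₂)))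
  H₂≢H₃ : H₂ ≢ H₃
  H₂≢H₃ H₂≡H₃ = φH₁≢0 (cong coords (identityˡ-unique (label H₁) (label H₂)
    (sym (trans (cong label H₂≡H₃) label₃))))
  H₁≢H₃ : H₁ ≢ H₃
  H₁≢H₃ H₁≡H₃ = φH₂≢0 (cong coords (identityʳ-unique (label H₁) (label H₂)
    (sym (trans (cong label H₁≡H₃) label₃))))
  c₁₂ : Commute (label H₁) (label H₂)
  c₁₂ = ω≡false⇒commute (label H₁) (label H₂) ω≡false

mainTheorem3 :
    ((H : Subset 5) → IsGeomHyperplane H → p2 ∈ H → label H ≢ II)
    × ((H K : Subset 5) → IsGeomHyperplane H → p2 ∈ H →
         IsGeomHyperplane K → p2 ∈ K → label H ≡ label K → H ≡ K)
    × ((P : Pauli2) → P ≢ II →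
         Σ (Subset 5) (λ H → IsGeomHyperplane H × p2 ∈ H × label H ≡ P))
    × ((H₁ H₂ H₃ : Subset 5) → IsVeldkampLine H₁ H₂ H₃ →
         (label H₁ · label H₂) · label H₃ ≡ II)
    × Σ (Subset 5 → V4) (λ φ →
        ((H : Subset 5) → IsGeomHyperplane H → p2 ∈ H → IsWPoint (φ H))
        × ((H K : Subset 5) → IsGeomHyperplane H → p2 ∈ H →
             IsGeomHyperplane K → p2 ∈ K → φ H ≡ φ K → H ≡ K)
        × ((u : V4) → IsWPoint u →
             Σ (Subset 5) (λ H → IsGeomHyperplane H × p2 ∈ H × φ H ≡ u))
        × ((H₁ H₂ H₃ : Subset 5) → IsVeldkampLine H₁ H₂ H₃ →
             Commute (label H₁) (label H₂) → Commute (label H₂) (label H₃) →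
             Commute (label H₁) (label H₃) →
             (p2 ∈ H₁ × p2 ∈ H₂ × p2 ∈ H₃) × IsWLine (φ H₁) (φ H₂) (φ H₃))
        × ((H₁ H₂ H₃ : Subset 5) →
             IsGeomHyperplane H₁ → p2 ∈ H₁ → IsGeomHyperplane H₂ → p2 ∈ H₂ →
             IsGeomHyperplane H₃ → p2 ∈ H₃ → IsWLine (φ H₁) (φ H₂) (φ H₃) →
             IsVeldkampLine H₁ H₂ H₃ × Commute (label H₁) (label H₂)
             × Commute (label H₂) (label H₃) × Commute (label H₁) (label H₃)))
mainTheorem3 =
  (λ _ → label-≢II) ,
  (λ _ _ _ p2∈H _ p2∈K → label-injective p2∈H p2∈K) ,
  label-surjective ,
  (λ _ _ _ → veldkampLine-product) ,
  φ ,
  (λ _ → hyperplane-φ≢0) ,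
  (λ _ _ _ p2∈H _ p2∈K → φ-injective p2∈H p2∈K) ,
  φ-surjective ,
  (λ _ _ _ v c₁₂ _ _ → commutingVeldkampLine⇒WLine v c₁₂) ,
  (λ _ _ _ → WLine⇒commutingVeldkampLine)
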